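{- Let $a,b$ be natural numbers with $\gcd(10a,b)=1$ and $a<b$. Let $e$ be the multiplicative order of $10$ modulo $b$, and let $a/b=0.\dot{c_1}\cdots\dot{c_e}=0.c_1\cdots c_ec_1\cdots c_e\cdots$ ($0\le c_i\le 9$) be the purely periodic decimal expansion of $a/b$. Suppose $e=ln$ for natural numbers $l$ and $n>1$. Define natural numbers $L,B$ by $L=\gcd(10^l-1,b)$ and $b=BL$. For $i=0,1,\dots,n-1$ let $s_i$ be the integer with $0\le s_i<b$ and $s_i\equiv 10^{li}a \pmod b$. For $j=0,\dots,n-1$ let $N_j$ denote the integer whose decimal digits are $c_{jl+1}c_{jl+2}\cdots c_{(j+1)l}$. Then $k:=\sum_{i=0}^{n-1}s_i/B$ is an integer and $$N_0+N_1+\dots+N_{n-1}=k\,\frac{10^l-1}{L}.$$ Moreover, in the case $a=1$, $n=2$, the integer $k$ is uniquely determined by the conditions $Bk\equiv 2\pmod L$ and $1\le k\le L$. -}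

module Defs where

open import Data.Nat using (ℕ; zero; suc; _+_; _*_; _∸_; _^_; _≤_; _<_; _/_; _%_)
open import Data.Integer as ℤ using (ℤ; +_)
open import Data.Integer.Divisibility as ℤd using ()
open import Data.Product using (_×_)

sumTo : ℕ → (ℕ → ℕ) → ℕ
sumTo zero    f = 0
sumTo (suc n) f = sumTo n f + f n

infix 4 _≡_[mod_]
_≡_[mod_] : ℕ → ℕ → ℕ → Set
x ≡ y [mod m ] = (+ m) ℤd.∣ ((+ x) ℤ.- (+ y))

IsOrderOf10Mod : ℕ → ℕ → Set
IsOrderOf10Mod e b =
  0 < e × (10 ^ e ≡ 1 [mod b ]) × (∀ d → 0 < d → 10 ^ d ≡ 1 [mod b ] → e ≤ d)

digit : (a b : ℕ) → .{{_ : Data.Nat.NonZero b}} → ℕ → ℕ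
digit a b i = ((10 ^ i * a) / b) % 10

digitBlock : (a b : ℕ) → .{{_ : Data.Nat.NonZero b}} → (p l : ℕ) → ℕ
digitBlock a b p zero    = 0
digitBlock a b p (suc l) = digitBlock a b p l * 10 + digit a b (p + suc l)

-- Long division by b: with s_i the remainder of 10^(li) a modulo b, the j-th block of l digits
-- satisfies N_j b + s_(j+1) = 10^l s_j.  Summed over j the remainders telescope cyclically, as
-- s_n = s_0 when 10^(ln) ≡ 1 (mod b), so (Σ N_j) b = (10^l - 1) Σ s_i.  With L = gcd(10^l - 1, b),
-- b = B L and 10^l - 1 = M L where B and M are coprime, so B divides Σ s_i.
-- For a = 1 and n = 2, Σ s_i = 1 + s_1 ≡ 1 + 10^l ≡ 2 (mod L).  Since b divides
-- (10^l - 1)(10^l + 1), B divides 10^l + 1, so gcd(B, L) divides 2 and hence is 1, b being prime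
-- to 10; thus B is invertible mod L, and 1 ≤ k ≤ L because 1 ≤ B k ≤ b.

module Submission where

open import Defs
open import Data.Nat using (ℕ; _+_; _*_; _∸_; _^_; _≤_; _<_; _%_; NonZero)
open import Data.Nat.GCD using (gcd)
open import Data.Product using (_×_; ∃)
open import Relation.Binary.PropositionalEquality using (_≡_)

open import Data.Nat using (zero; suc; _/_; ∣_-_∣; ≢-nonZero; ≢-nonZero⁻¹)
open import Data.Nat.Properties
open import Data.Nat.DivMod
open import Data.Nat.Divisibility
open import Data.Nat.GCD using (gcd[m,n]∣m; gcd[m,n]∣n; gcd[m,n]≢0)
open import Data.Nat.Coprimality as Coprime using (Coprime; coprime-divisor; coprime-/gcd; gcd≡1⇒coprime)
open import Data.Nat.Tactic.RingSolver using (solve-∀)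
import Data.Integer as ℤ
import Data.Integer.Properties as ℤₚ
open import Data.Product using (_,_)
open import Data.Sum using (inj₁; inj₂)
open import Function using (_∘_)
open import Relation.Binary.PropositionalEquality
  using (refl; sym; trans; cong; cong₂; subst; subst₂; module ≡-Reasoning)
open ≡-Reasoning

∣+m-+n∣≡∣m-n∣ : ∀ m n → ℤ.∣ ℤ.+ m ℤ.- ℤ.+ n ∣ ≡ ∣ m - n ∣
∣+m-+n∣≡∣m-n∣ m n rewrite ℤₚ.m-n≡m⊖n m n with ≤-total m n
... | inj₁ m≤n = trans (ℤₚ.∣⊖∣-≤ m≤n) (sym (m≤n⇒∣m-n∣≡n∸m m≤n))
... | inj₂ n≤m = begin
  ℤ.∣ m ℤ.⊖ n ∣ ≡⟨ ℤₚ.∣m⊖n∣≡∣n⊖m∣ m n ⟩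
  ℤ.∣ n ℤ.⊖ m ∣ ≡⟨ ℤₚ.∣⊖∣-≤ n≤m ⟩
  m ∸ n         ≡⟨ sym (m≤n⇒∣m-n∣≡n∸m n≤m) ⟩
  ∣ n - m ∣     ≡⟨ ∣-∣-comm n m ⟩
  ∣ m - n ∣     ∎

module _ {m : ℕ} .{{_ : NonZero m}} where

  %≡%⇒∣∸ : ∀ x y → x % m ≡ y % m → m ∣ y ∸ x
  %≡%⇒∣∸ x y eq = divides (y / m ∸ x / m) (begin
    y ∸ x                                     ≡⟨ cong₂ _∸_ (m≡m%n+[m/n]*n y m) (m≡m%n+[m/n]*n x m) ⟩
    (y % m + y / m * m) ∸ (x % m + x / m * m) ≡⟨ cong (λ t → (y % m + y / m * m) ∸ (t + x / m * m)) eq ⟩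
    (y % m + y / m * m) ∸ (y % m + x / m * m) ≡⟨ [m+n]∸[m+o]≡n∸o (y % m) _ _ ⟩
    y / m * m ∸ x / m * m                     ≡⟨ sym (*-distribʳ-∸ m (y / m) (x / m)) ⟩
    (y / m ∸ x / m) * m                       ∎)

  ∣∸⇒%≡% : ∀ {x y} → x ≤ y → m ∣ y ∸ x → x % m ≡ y % m
  ∣∸⇒%≡% {x} x≤y m∣y∸x = sym (trans (cong (_% m) (sym (m+[n∸m]≡n x≤y))) (%-remove-+ʳ x m∣y∸x))

  %≡%⇒∣∣-∣ : ∀ x y → x % m ≡ y % m → m ∣ ∣ x - y ∣
  %≡%⇒∣∣-∣ x y eq with ≤-total x y
  ... | inj₁ x≤y = subst (m ∣_) (sym (m≤n⇒∣m-n∣≡n∸m x≤y)) (%≡%⇒∣∸ x y eq)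
  ... | inj₂ y≤x = subst (m ∣_) (sym (trans (∣-∣-comm x y) (m≤n⇒∣m-n∣≡n∸m y≤x))) (%≡%⇒∣∸ y x (sym eq))

  ∣∣-∣⇒%≡% : ∀ x y → m ∣ ∣ x - y ∣ → x % m ≡ y % m
  ∣∣-∣⇒%≡% x y m∣∣x-y∣ with ≤-total x y
  ... | inj₁ x≤y = ∣∸⇒%≡% x≤y (subst (m ∣_) (m≤n⇒∣m-n∣≡n∸m x≤y) m∣∣x-y∣)
  ... | inj₂ y≤x = sym (∣∸⇒%≡% y≤x (subst (m ∣_) (trans (∣-∣-comm x y) (m≤n⇒∣m-n∣≡n∸m y≤x)) m∣∣x-y∣))

  ≡[mod]⇒%≡% : ∀ {x y} → x ≡ y [mod m ] → x % m ≡ y % m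
  ≡[mod]⇒%≡% {x} {y} x≡y = ∣∣-∣⇒%≡% x y (subst (m ∣_) (∣+m-+n∣≡∣m-n∣ x y) x≡y)

  %≡%⇒≡[mod] : ∀ {x y} → x % m ≡ y % m → x ≡ y [mod m ]
  %≡%⇒≡[mod] {x} {y} eq = subst (m ∣_) (sym (∣+m-+n∣≡∣m-n∣ x y)) (%≡%⇒∣∣-∣ x y eq)

  *-cancelˡ-%≡ : ∀ {c x y} → Coprime c m → c * x % m ≡ c * y % m → x % m ≡ y % m
  *-cancelˡ-%≡ {c} {x} {y} c⊥m eq = ∣∣-∣⇒%≡% x y (coprime-divisor (Coprime.sym c⊥m)
    (subst (m ∣_) (sym (*-distribˡ-∣-∣ c x y)) (%≡%⇒∣∣-∣ (c * x) (c * y) eq)))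

  %-injective-[1,m] : ∀ {x y} → 1 ≤ x → x ≤ m → 1 ≤ y → y ≤ m → x % m ≡ y % m → x ≡ y
  %-injective-[1,m] 1≤x x≤m 1≤y y≤m eq = ≤-antisym (≤-of-%≡% 1≤y y≤m x≤m (sym eq)) (≤-of-%≡% 1≤x x≤m y≤m eq)
    where
    ≤-of-%≡% : ∀ {x y} → 1 ≤ x → x ≤ m → y ≤ m → x % m ≡ y % m → y ≤ x
    ≤-of-%≡% {x} {y} 1≤x x≤m y≤m eq = m∸n≡0⇒m≤n (trans (sym (m<n⇒m%n≡m y∸x<m)) (n∣m⇒m%n≡0 (y ∸ x) m (%≡%⇒∣∸ x y eq)))
      where
      y∸x<m : y ∸ x < m
      y∸x<m = ≤-<-trans (∸-monoˡ-≤ x y≤m) (∸-monoʳ-< {m} {x} {0} 1≤x x≤m)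

sumTo-cong : ∀ n {f g : ℕ → ℕ} → (∀ i → f i ≡ g i) → sumTo n f ≡ sumTo n g
sumTo-cong zero    f≗g = refl
sumTo-cong (suc n) f≗g = cong₂ _+_ (sumTo-cong n f≗g) (f≗g n)

sumTo-distrib-+ : ∀ n (f g : ℕ → ℕ) → sumTo n (λ i → f i + g i) ≡ sumTo n f + sumTo n g
sumTo-distrib-+ zero    f g = refl
sumTo-distrib-+ (suc n) f g = trans (cong (_+ (f n + g n)) (sumTo-distrib-+ n f g)) (interchange (sumTo n f) (sumTo n g) (f n) (g n))
  where
  interchange : ∀ w x y z → (w + x) + (y + z) ≡ (w + y) + (x + z)
  interchange = solve-∀

sumTo-*ˡ : ∀ n c (f : ℕ → ℕ) → sumTo n (λ i → c * f i) ≡ c * sumTo n f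
sumTo-*ˡ zero    c f = sym (*-zeroʳ c)
sumTo-*ˡ (suc n) c f = trans (cong (_+ c * f n) (sumTo-*ˡ n c f)) (sym (*-distribˡ-+ c (sumTo n f) (f n)))

sumTo-*ʳ : ∀ n c (f : ℕ → ℕ) → sumTo n (λ i → f i * c) ≡ sumTo n f * c
sumTo-*ʳ zero    c f = refl
sumTo-*ʳ (suc n) c f = trans (cong (_+ f n * c) (sumTo-*ʳ n c f)) (sym (*-distribʳ-+ c (sumTo n f) (f n)))

sumTo-suc : ∀ n (f : ℕ → ℕ) → sumTo (suc n) f ≡ f 0 + sumTo n (f ∘ suc)
sumTo-suc zero    f = sym (+-identityʳ (f 0))
sumTo-suc (suc n) f = trans (cong (_+ f (suc n)) (sumTo-suc n f)) (+-assoc (f 0) _ _)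

sumTo-rotate : ∀ n (f : ℕ → ℕ) → f n ≡ f 0 → sumTo n (f ∘ suc) ≡ sumTo n f
sumTo-rotate n f fn≡f0 = +-cancelˡ-≡ (f 0) _ _ (begin
  f 0 + sumTo n (f ∘ suc) ≡⟨ sym (sumTo-suc n f) ⟩
  sumTo n f + f n         ≡⟨ cong (sumTo n f +_) fn≡f0 ⟩
  sumTo n f + f 0         ≡⟨ +-comm (sumTo n f) (f 0) ⟩
  f 0 + sumTo n f         ∎)

sumTo-telescope : ∀ n x (f g : ℕ → ℕ) → f n ≡ f 0 → (∀ i → g i + f (suc i) ≡ x * f i) →
                  sumTo n g ≡ (x ∸ 1) * sumTo n f
sumTo-telescope n x f g fn≡f0 step = begin
  G             ≡⟨ sym (m+n∸n≡m G F) ⟩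
  G + F ∸ F     ≡⟨ cong (_∸ F) G+F≡x*F ⟩
  x * F ∸ F     ≡⟨ cong (x * F ∸_) (sym (*-identityˡ F)) ⟩
  x * F ∸ 1 * F ≡⟨ sym (*-distribʳ-∸ F x 1) ⟩
  (x ∸ 1) * F   ∎
  where
  F G : ℕ
  F = sumTo n f
  G = sumTo n g
  G+F≡x*F : G + F ≡ x * F
  G+F≡x*F = begin
    G + F                           ≡⟨ cong (G +_) (sym (sumTo-rotate n f fn≡f0)) ⟩
    G + sumTo n (f ∘ suc)           ≡⟨ sym (sumTo-distrib-+ n g (f ∘ suc)) ⟩
    sumTo n (λ i → g i + f (suc i)) ≡⟨ sumTo-cong n step ⟩
    sumTo n (λ i → x * f i)         ≡⟨ sumTo-*ˡ n x f ⟩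
    x * F                           ∎

[o*m]/n/o≡m/n : ∀ m n o .{{_ : NonZero n}} .{{_ : NonZero o}} → o * m / n / o ≡ m / n
[o*m]/n/o≡m/n m n o = begin
  o * m / n / o   ≡⟨ m/n/o≡m/[n*o] (o * m) n o ⟩
  o * m / (n * o) ≡⟨ /-congʳ (*-comm n o) ⟩
  o * m / (o * n) ≡⟨ m*n/m*o≡n/o o m n ⟩
  m / n           ∎
  where
  instance
    n*o≢0 : NonZero (n * o)
    n*o≢0 = m*n≢0 n o
    o*n≢0 : NonZero (o * n)
    o*n≢0 = m*n≢0 o n

module DecimalExpansion (a b : ℕ) .{{_ : NonZero b}} where

  quot rem : ℕ → ℕ
  quot i = 10 ^ i * a / b
  rem  i = 10 ^ i * a % b

  quot-suc : ∀ i → quot (suc i) ≡ quot i * 10 + digit a b (suc i)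
  quot-suc i = begin
    quot (suc i)                               ≡⟨ m≡m%n+[m/n]*n (quot (suc i)) 10 ⟩
    digit a b (suc i) + quot (suc i) / 10 * 10 ≡⟨ +-comm (digit a b (suc i)) _ ⟩
    quot (suc i) / 10 * 10 + digit a b (suc i) ≡⟨ cong (λ t → t * 10 + digit a b (suc i)) quot-suc/10 ⟩
    quot i * 10 + digit a b (suc i)            ∎
    where
    quot-suc/10 : quot (suc i) / 10 ≡ quot i
    quot-suc/10 = trans (cong (λ t → t / b / 10) (*-assoc 10 (10 ^ i) a)) ([o*m]/n/o≡m/n (10 ^ i * a) b 10)

  quot*b+rem : ∀ i → quot i * b + rem i ≡ 10 ^ i * a
  quot*b+rem i = trans (+-comm (quot i * b) (rem i)) (sym (m≡m%n+[m/n]*n (10 ^ i * a) b))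

  digit*b+rem : ∀ i → digit a b (suc i) * b + rem (suc i) ≡ 10 * rem i
  digit*b+rem i = +-cancelˡ-≡ (quot i * 10 * b) _ _ (begin
    quot i * 10 * b + (c * b + rem (suc i)) ≡⟨ regroup (quot i) c b (rem (suc i)) ⟩
    (quot i * 10 + c) * b + rem (suc i)     ≡⟨ cong (λ t → t * b + rem (suc i)) (sym (quot-suc i)) ⟩
    quot (suc i) * b + rem (suc i)          ≡⟨ quot*b+rem (suc i) ⟩
    10 * 10 ^ i * a                         ≡⟨ *-assoc 10 (10 ^ i) a ⟩
    10 * (10 ^ i * a)                       ≡⟨ cong (10 *_) (sym (quot*b+rem i)) ⟩
    10 * (quot i * b + rem i)               ≡⟨ distribute (quot i) b (rem i) ⟩
    quot i * 10 * b + 10 * rem i            ∎)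
    where
    c : ℕ
    c = digit a b (suc i)
    regroup : ∀ q c b r → q * 10 * b + (c * b + r) ≡ (q * 10 + c) * b + r
    regroup = solve-∀
    distribute : ∀ q b r → 10 * (q * b + r) ≡ q * 10 * b + 10 * r
    distribute = solve-∀

  digitBlock*b+rem : ∀ p l → digitBlock a b p l * b + rem (p + l) ≡ 10 ^ l * rem p
  digitBlock*b+rem p zero = trans (cong rem (+-identityʳ p)) (sym (*-identityˡ (rem p)))
  digitBlock*b+rem p (suc l) rewrite +-suc p l = begin
    (N * 10 + c) * b + rem (suc (p + l))     ≡⟨ regroup N c b (rem (suc (p + l))) ⟩
    N * b * 10 + (c * b + rem (suc (p + l))) ≡⟨ cong (N * b * 10 +_) (digit*b+rem (p + l)) ⟩
    N * b * 10 + 10 * rem (p + l)            ≡⟨ factor (N * b) (rem (p + l)) ⟩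
    10 * (N * b + rem (p + l))               ≡⟨ cong (10 *_) (digitBlock*b+rem p l) ⟩
    10 * (10 ^ l * rem p)                    ≡⟨ sym (*-assoc 10 (10 ^ l) (rem p)) ⟩
    10 ^ suc l * rem p                       ∎
    where
    N c : ℕ
    N = digitBlock a b p l
    c = digit a b (suc (p + l))
    regroup : ∀ n c b r → (n * 10 + c) * b + r ≡ n * b * 10 + (c * b + r)
    regroup = solve-∀
    factor : ∀ x r → x * 10 + 10 * r ≡ 10 * (x + r)
    factor = solve-∀

  rem-period : ∀ e → 10 ^ e ≡ 1 [mod b ] → rem e ≡ rem 0
  rem-period e 10^e≡1 = begin
    10 ^ e * a % b             ≡⟨ %-distribˡ-* (10 ^ e) a b ⟩
    (10 ^ e % b) * (a % b) % b ≡⟨ cong (λ t → t * (a % b) % b) (≡[mod]⇒%≡% 10^e≡1) ⟩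
    (1 % b) * (a % b) % b      ≡⟨ sym (%-distribˡ-* 1 a b) ⟩
    1 * a % b                  ∎

digitBlocks-sum : ∀ a b .{{_ : NonZero b}} l n → 10 ^ (l * n) ≡ 1 [mod b ] →
  sumTo n (λ j → digitBlock a b (j * l) l) * b ≡ (10 ^ l ∸ 1) * sumTo n (λ i → 10 ^ (l * i) * a % b)
digitBlocks-sum a b l n period =
  trans (sym (sumTo-*ʳ n b N)) (sumTo-telescope n (10 ^ l) s (λ j → N j * b) s-period block)
  where
  open DecimalExpansion a b
  N s : ℕ → ℕ
  N j = digitBlock a b (j * l) l
  s i = rem (l * i)
  s-period : s n ≡ s 0
  s-period = trans (rem-period (l * n) period) (cong rem (sym (*-zeroʳ l)))
  l*[1+j]≡j*l+l : ∀ l j → l * suc j ≡ j * l + l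
  l*[1+j]≡j*l+l = solve-∀
  block : ∀ j → N j * b + s (suc j) ≡ 10 ^ l * s j
  block j = begin
    N j * b + rem (l * suc j) ≡⟨ cong (λ t → N j * b + rem t) (l*[1+j]≡j*l+l l j) ⟩
    N j * b + rem (j * l + l) ≡⟨ digitBlock*b+rem (j * l) l ⟩
    10 ^ l * rem (j * l)      ≡⟨ cong (λ t → 10 ^ l * rem t) (*-comm j l) ⟩
    10 ^ l * s j              ∎

gcd-nonZero : ∀ m n .{{_ : NonZero n}} → NonZero (gcd m n)
gcd-nonZero m n = ≢-nonZero (gcd[m,n]≢0 m n (inj₂ (≢-nonZero⁻¹ n)))

coprime-gcd-cofactors : ∀ {m n p q} .{{_ : NonZero (gcd m n)}} →
                        m ≡ p * gcd m n → n ≡ q * gcd m n → Coprime p q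
coprime-gcd-cofactors {m} {n} m≡p*g n≡q*g = subst₂ Coprime (cofactor m≡p*g) (cofactor n≡q*g) (coprime-/gcd m n)
  where
  cofactor : ∀ {x y} → x ≡ y * gcd m n → x / gcd m n ≡ y
  cofactor {y = y} x≡y*g = trans (/-congˡ x≡y*g) (m*n/n≡m y (gcd m n))

∣*⇒cofactor∣ : ∀ x {y b B} .{{_ : NonZero b}} → b ≡ B * gcd x b → b ∣ x * y → B ∣ y
∣*⇒cofactor∣ x {y} {b} {B} b≡B*L b∣x*y =
  coprime-divisor B⊥M (*-cancelʳ-∣ L (subst₂ _∣_ b≡B*L x*y≡M*y*L b∣x*y))
  where
  L : ℕ
  L = gcd x b
  instance
    L≢0 : NonZero L
    L≢0 = gcd-nonZero x b
  M : ℕ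
  M = x / L
  x≡M*L : x ≡ M * L
  x≡M*L = sym (m/n*n≡m (gcd[m,n]∣m x b))
  B⊥M : Coprime B M
  B⊥M = Coprime.sym (coprime-gcd-cofactors x≡M*L b≡B*L)
  swap : ∀ m l y → m * l * y ≡ m * y * l
  swap = solve-∀
  x*y≡M*y*L : x * y ≡ M * y * L
  x*y≡M*y*L = trans (cong (_* y) x≡M*L) (swap M L y)

cofactor-nonZero : ∀ {b B L} .{{_ : NonZero b}} → b ≡ B * L → NonZero B
cofactor-nonZero {b} {L = L} b≡B*L = ≢-nonZero (λ B≡0 → ≢-nonZero⁻¹ b (trans b≡B*L (cong (_* L) B≡0)))

proportion-via-gcd : ∀ {b} .{{_ : NonZero b}} x B S T → b ≡ B * gcd x b → T * b ≡ x * S →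
                     ∃ λ k → S ≡ B * k × T * gcd x b ≡ k * x
proportion-via-gcd {b} x B S T b≡B*L T*b≡x*S = k , S≡B*k , *-cancelʳ-≡ (T * L) (k * x) B (begin
  T * L * B   ≡⟨ reorderˡ T L B ⟩
  T * (B * L) ≡⟨ cong (T *_) (sym b≡B*L) ⟩
  T * b       ≡⟨ T*b≡x*S ⟩
  x * S       ≡⟨ cong (x *_) S≡B*k ⟩
  x * (B * k) ≡⟨ reorderʳ x B k ⟩
  k * x * B   ∎)
  where
  L : ℕ
  L = gcd x b
  instance
    B≢0 : NonZero B
    B≢0 = cofactor-nonZero b≡B*L
  B∣S : B ∣ S
  B∣S = ∣*⇒cofactor∣ x b≡B*L (divides T (sym T*b≡x*S))
  k : ℕ
  k = quotient B∣S
  S≡B*k : S ≡ B * k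
  S≡B*k = m∣n⇒n≡m*quotient B∣S
  reorderˡ : ∀ t l b → t * l * b ≡ t * (b * l)
  reorderˡ = solve-∀
  reorderʳ : ∀ x b k → x * (b * k) ≡ k * x * b
  reorderʳ = solve-∀

m^2∸1≡[m∸1]*[m+1] : ∀ m → m ^ 2 ∸ 1 ≡ (m ∸ 1) * (m + 1)
m^2∸1≡[m∸1]*[m+1] zero    = refl
m^2∸1≡[m∸1]*[m+1] (suc m) = expand m
  where
  -- the goal for suc m, after unfolding _^_, _*_ and _∸_
  expand : ∀ m → m * 1 + m * suc (m * 1) ≡ m * (suc m + 1)
  expand = solve-∀

module TwoBlocks {b : ℕ} .{{_ : NonZero b}} (10⊥b : Coprime 10 b) (1<b : 1 < b)
  (l : ℕ) (period : 10 ^ (l * 2) ≡ 1 [mod b ])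
  (B : ℕ) (b≡B*L : b ≡ B * gcd (10 ^ l ∸ 1) b)
  (k : ℕ) (S≡B*k : sumTo 2 (λ i → 10 ^ (l * i) * 1 % b) ≡ B * k) where

  X L : ℕ
  X = 10 ^ l
  L = gcd (X ∸ 1) b

  instance
    L≢0 : NonZero L
    L≢0 = gcd-nonZero (X ∸ 1) b
    B≢0 : NonZero B
    B≢0 = cofactor-nonZero b≡B*L

  1≤X : 1 ≤ X
  1≤X = m^n>0 10 l

  L∣b : L ∣ b
  L∣b = gcd[m,n]∣n (X ∸ 1) b

  L∣X∸1 : L ∣ X ∸ 1
  L∣X∸1 = gcd[m,n]∣m (X ∸ 1) b

  b∣[X∸1]*[X+1] : b ∣ (X ∸ 1) * (X + 1)
  b∣[X∸1]*[X+1] = subst (b ∣_) X^2∸1≡[X∸1]*[X+1] (%≡%⇒∣∸ 1 (10 ^ (l * 2)) (sym (≡[mod]⇒%≡% period)))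
    where
    X^2∸1≡[X∸1]*[X+1] : 10 ^ (l * 2) ∸ 1 ≡ (X ∸ 1) * (X + 1)
    X^2∸1≡[X∸1]*[X+1] = trans (cong (_∸ 1) (sym (^-*-assoc 10 l 2))) (m^2∸1≡[m∸1]*[m+1] X)

  B⊥L : Coprime B L
  B⊥L {d} (d∣B , d∣L) = 10⊥b (∣-trans d∣2 (divides 5 refl) , ∣-trans d∣L L∣b)
    where
    X+1≡[X∸1]+2 : X + 1 ≡ (X ∸ 1) + 2
    X+1≡[X∸1]+2 = sym (trans (sym (+-assoc (X ∸ 1) 1 1)) (cong (_+ 1) (m∸n+n≡m 1≤X)))
    d∣2 : d ∣ 2
    d∣2 = ∣m+n∣m⇒∣n (subst (d ∣_) X+1≡[X∸1]+2 (∣-trans d∣B (∣*⇒cofactor∣ (X ∸ 1) b≡B*L b∣[X∸1]*[X+1])))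
                     (∣-trans d∣L L∣X∸1)

  B*k≡1+X%b : B * k ≡ suc (X % b)
  B*k≡1+X%b = trans (sym S≡B*k) (cong₂ _+_ s₀≡1 s₁≡X%b)
    where
    s₀≡1 : 10 ^ (l * 0) * 1 % b ≡ 1
    s₀≡1 = trans (cong (λ t → 10 ^ t * 1 % b) (*-zeroʳ l)) (m<n⇒m%n≡m 1<b)
    s₁≡X%b : 10 ^ (l * 1) * 1 % b ≡ X % b
    s₁≡X%b = cong (_% b) (trans (*-identityʳ _) (cong (10 ^_) (*-identityʳ l)))

  B*k%L≡2%L : B * k % L ≡ 2 % L
  B*k%L≡2%L = begin
    B * k % L                ≡⟨ %-congˡ {o = L} B*k≡1+X%b ⟩
    (1 + X % b) % L          ≡⟨ %-distribˡ-+ 1 (X % b) L ⟩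
    (1 % L + X % b % L) % L  ≡⟨ cong (λ t → (1 % L + t) % L) X%b%L≡1%L ⟩
    (1 % L + 1 % L) % L      ≡⟨ sym (%-distribˡ-+ 1 1 L) ⟩
    2 % L                    ∎
    where
    X%b%L≡1%L : X % b % L ≡ 1 % L
    X%b%L≡1%L = trans (m∣n⇒o%n%m≡o%m L b X L∣b) (sym (∣∸⇒%≡% 1≤X L∣X∸1))

  1≤k : 1 ≤ k
  1≤k = n≢0⇒n>0 (λ k≡0 → 1+n≢0 (trans (sym B*k≡1+X%b) (trans (cong (B *_) k≡0) (*-zeroʳ B))))

  k≤L : k ≤ L
  k≤L = *-cancelˡ-≤ B (subst (B * k ≤_) b≡B*L (subst (_≤ b) (sym B*k≡1+X%b) (m%n<n X b)))

  k-unique : ∀ k′ → B * k′ ≡ 2 [mod L ] → 1 ≤ k′ → k′ ≤ L → k′ ≡ k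
  k-unique k′ B*k′≡2 1≤k′ k′≤L = %-injective-[1,m] 1≤k′ k′≤L 1≤k k≤L
    (*-cancelˡ-%≡ B⊥L (trans (≡[mod]⇒%≡% B*k′≡2) (sym B*k%L≡2%L)))

theorem2p1 : (a b : ℕ) → .{{_ : NonZero b}} → gcd (10 * a) b ≡ 1 → a < b →
  (e : ℕ) → IsOrderOf10Mod e b →
  (l n : ℕ) → e ≡ l * n → 1 < n →
  (L B : ℕ) → L ≡ gcd (10 ^ l ∸ 1) b → b ≡ B * L →
  ∃ λ k →
    sumTo n (λ i → (10 ^ (l * i) * a) % b) ≡ B * k
    × sumTo n (λ j → digitBlock a b (j * l) l) * L ≡ k * (10 ^ l ∸ 1)
    × (a ≡ 1 → n ≡ 2 →
        (B * k ≡ 2 [mod L ]) × 1 ≤ k × k ≤ L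
        × (∀ k′ → B * k′ ≡ 2 [mod L ] → 1 ≤ k′ → k′ ≤ L → k′ ≡ k))
theorem2p1 a b gcd≡1 a<b e (_ , period , _) l n refl _ L B refl b≡B*L =
  let k , S≡B*k , T*L≡k*x = proportion-via-gcd (10 ^ l ∸ 1) B S T b≡B*L (digitBlocks-sum a b l n period)
  in k , S≡B*k , T*L≡k*x , λ { refl refl →
       let open TwoBlocks (gcd≡1⇒coprime gcd≡1) a<b l period B b≡B*L k S≡B*k
       in %≡%⇒≡[mod] B*k%L≡2%L , 1≤k , k≤L , k-unique }
  where
  S T : ℕ
  S = sumTo n (λ i → 10 ^ (l * i) * a % b)
  T = sumTo n (λ j → digitBlock a b (j * l) l)
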